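{- Let $\Delta_0$ be the plane triangle with vertices $x,y_0,z$. For $i\geq 1$, let $\Delta_i$ be the plane triangulation obtained from $\Delta_{i-1}$ (whose outer face has boundary $\{x,y_{i-1},z\}$) by inserting a new vertex $y_i$ in the outer face of $\Delta_{i-1}$ and joining $y_i$ to each of $x,y_{i-1},z$, so that the outer face of $\Delta_i$ has boundary $\{x,y_i,z\}$ (thus $\Delta_n$ has $n+3$ vertices). Let $n>0$. Then there exists a unique pair $\{\sigma,-\sigma\}$ of satisfying spin-assignments on $\Delta_n$ such that the edge $xy_n$ is monochromatic; that is, the satisfying spin-assignments $\tau$ on $\Delta_n$ with $\tau(x)=\tau(y_n)$ are exactly $\sigma$ and $-\sigma$ for a single $\sigma$.
   Context: A spin-assignment on a plane triangulation $\Delta$ is a function $\sigma: V(\Delta)\to\{+1,-1\}$. An edge $uv$ is monochromatic under $\sigma$ if $\sigma(u)=\sigma(v)$. A spin-assignment is satisfying if every face of $\Delta$ (including the outer face) has exactly one monochromatic edge in its boundary $3$-cycle, equivalently no face boundary is monochromatic (all three vertices having the same spin). -}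

module Defs where

open import Data.Nat using (ℕ; zero; suc; _+_)
open import Data.Fin using (Fin; fromℕ; inject₁)
  renaming (suc to fsuc; zero to fzero)
open import Data.Product using (_×_; _,_)
open import Relation.Binary.PropositionalEquality using (_≡_)

data Spin : Set where
  plus minus : Spin

neg : Spin → Spin
neg plus  = minus
neg minus = plus

monoCount : Spin → Spin → ℕ
monoCount plus  plus  = 1
monoCount minus minus = 1
monoCount plus  minus = 0
monoCount minus plus  = 0

data Vertex (n : ℕ) : Set where
  vx : Vertex n
  vz : Vertex n
  vy : Fin (suc n) → Vertex n

yLast : (n : ℕ) → Vertex n
yLast n = vy (fromℕ n)

-- Faces of Δ_n (including the outer face).
--   inner      : the bounded face {x, y_0, z} of Δ_0
--   left  i    : {x, y_i, y_{i+1}}   (i = 0 … n-1), created when y_{i+1} is inserted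
--   right i    : {y_i, z, y_{i+1}}   (i = 0 … n-1), created when y_{i+1} is inserted
--   outer      : the outer face {x, y_n, z}
data Face (n : ℕ) : Set where
  inner : Face n
  left  : Fin n → Face n
  right : Fin n → Face n
  outer : Face n

boundary : {n : ℕ} → Face n → Vertex n × Vertex n × Vertex n
boundary {n} inner     = vx , vy fzero , vz
boundary {n} (left i)  = vx , vy (inject₁ i) , vy (fsuc i)
boundary {n} (right i) = vy (inject₁ i) , vz , vy (fsuc i)
boundary {n} outer     = vx , vy (fromℕ n) , vz

SpinAssignment : ℕ → Set
SpinAssignment n = Vertex n → Spin

monoEdges : {n : ℕ} → SpinAssignment n → Vertex n × Vertex n × Vertex n → ℕ
monoEdges σ (a , b , c) = monoCount (σ a) (σ b) + monoCount (σ b) (σ c) + monoCount (σ a) (σ c)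

Satisfying : {n : ℕ} → SpinAssignment n → Set
Satisfying {n} σ = (f : Face n) → monoEdges σ (boundary f) ≡ 1

-- Once x and y_n agree, the outer face forces z = -x, and then the two faces
-- {x, y_i, y_{i+1}} and {y_i, z, y_{i+1}} together force y_i = -y_{i+1}: so every
-- spin is determined by the spin of x, alternating along y_n, y_{n-1}, …, y_0.
-- Conversely that alternating assignment satisfies every face, since each face
-- contains a pair of opposite spins.
module Submission where

open import Defs
open import Data.Nat using (ℕ; _<_; zero; suc; _+_)
open import Data.Fin using (Fin; fromℕ; inject₁) renaming (suc to fsuc; zero to fzero)
open import Data.Fin.Induction using (>-weakInduction)
open import Data.Product using (Σ; _×_; _,_)
open import Data.Sum using (_⊎_; inj₁; inj₂)
open import Function using (id)
open import Relation.Binary.PropositionalEquality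
  using (_≡_; refl; sym; trans; cong; subst)

OneMonochromatic : Spin → Spin → Spin → Set
OneMonochromatic a b c = monoCount a b + monoCount b c + monoCount a c ≡ 1

oneMonochromatic-neg₁₃ : ∀ a b → OneMonochromatic a b (neg a)
oneMonochromatic-neg₁₃ plus  plus  = refl
oneMonochromatic-neg₁₃ plus  minus = refl
oneMonochromatic-neg₁₃ minus plus  = refl
oneMonochromatic-neg₁₃ minus minus = refl

oneMonochromatic-neg₂₃ : ∀ a b → OneMonochromatic a (neg b) b
oneMonochromatic-neg₂₃ plus  plus  = refl
oneMonochromatic-neg₂₃ plus  minus = refl
oneMonochromatic-neg₂₃ minus plus  = refl
oneMonochromatic-neg₂₃ minus minus = refl

oneMonochromatic-neg₃₁ : ∀ a b → OneMonochromatic (neg a) b a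
oneMonochromatic-neg₃₁ plus  plus  = refl
oneMonochromatic-neg₃₁ plus  minus = refl
oneMonochromatic-neg₃₁ minus plus  = refl
oneMonochromatic-neg₃₁ minus minus = refl

oneMonochromatic-≡⇒neg : ∀ a c → OneMonochromatic a a c → c ≡ neg a
oneMonochromatic-≡⇒neg plus  plus  ()
oneMonochromatic-≡⇒neg plus  minus _ = refl
oneMonochromatic-≡⇒neg minus plus  _ = refl
oneMonochromatic-≡⇒neg minus minus ()

oneMonochromatic-fan : ∀ a b c →
  OneMonochromatic a b c → OneMonochromatic b (neg a) c → b ≡ neg c
oneMonochromatic-fan plus  plus  plus  () _
oneMonochromatic-fan plus  plus  minus _  _ = refl
oneMonochromatic-fan plus  minus plus  _  _ = refl
oneMonochromatic-fan plus  minus minus _  ()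
oneMonochromatic-fan minus plus  plus  _  ()
oneMonochromatic-fan minus plus  minus _  _ = refl
oneMonochromatic-fan minus minus plus  _  _ = refl
oneMonochromatic-fan minus minus minus () _

record Alternating {n : ℕ} (τ : SpinAssignment n) : Set where
  field
    z-opposite : τ vz ≡ neg (τ vx)
    top-equal  : τ vx ≡ τ (yLast n)
    y-step     : (i : Fin n) → τ (vy (inject₁ i)) ≡ neg (τ (vy (fsuc i)))

open Alternating

module _ {n : ℕ} where

  satisfying⇒alternating : {τ : SpinAssignment n} →
    Satisfying τ → τ vx ≡ τ (yLast n) → Alternating τ
  satisfying⇒alternating {τ} sat x≡y = record
    { z-opposite = z-opposite′
    ; top-equal  = x≡y
    ; y-step     = λ i → oneMonochromatic-fan (τ vx) (τ (vy (inject₁ i))) (τ (vy (fsuc i)))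
        (sat (left i))
        (subst (λ s → OneMonochromatic (τ (vy (inject₁ i))) s (τ (vy (fsuc i))))
               z-opposite′ (sat (right i)))
    }
    where
    z-opposite′ : τ vz ≡ neg (τ vx)
    z-opposite′ = oneMonochromatic-≡⇒neg (τ vx) (τ vz)
      (subst (λ s → OneMonochromatic (τ vx) s (τ vz)) (sym x≡y) (sat outer))

  alternating⇒satisfying : {τ : SpinAssignment n} → Alternating τ → Satisfying τ
  alternating⇒satisfying {τ} alt inner
    rewrite z-opposite alt = oneMonochromatic-neg₁₃ (τ vx) _
  alternating⇒satisfying {τ} alt outer
    rewrite z-opposite alt = oneMonochromatic-neg₁₃ (τ vx) _
  alternating⇒satisfying {τ} alt (left i)
    rewrite y-step alt i = oneMonochromatic-neg₂₃ (τ vx) (τ (vy (fsuc i)))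
  alternating⇒satisfying {τ} alt (right i)
    rewrite y-step alt i = oneMonochromatic-neg₃₁ (τ (vy (fsuc i))) (τ vz)

  alternating-neg : {τ : SpinAssignment n} → Alternating τ → Alternating (λ v → neg (τ v))
  alternating-neg alt = record
    { z-opposite = cong neg (z-opposite alt)
    ; top-equal  = cong neg (top-equal alt)
    ; y-step     = λ i → cong neg (y-step alt i)
    }

  alternating-resp : {τ τ′ : SpinAssignment n} →
    (∀ v → τ v ≡ τ′ v) → Alternating τ → Alternating τ′
  alternating-resp {τ} {τ′} τ≗τ′ alt = record
    { z-opposite = transport neg (z-opposite alt)
    ; top-equal  = transport id (top-equal alt)
    ; y-step     = λ i → transport neg (y-step alt i)
    }
    where
    transport : ∀ {u v} (f : Spin → Spin) → τ u ≡ f (τ v) → τ′ u ≡ f (τ′ v)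
    transport {u} {v} f e = trans (sym (τ≗τ′ u)) (trans e (cong f (τ≗τ′ v)))

  alternating-unique : {τ τ′ : SpinAssignment n} →
    Alternating τ → Alternating τ′ → τ vx ≡ τ′ vx → ∀ v → τ v ≡ τ′ v
  alternating-unique alt alt′ x≡ vx = x≡
  alternating-unique alt alt′ x≡ vz =
    trans (z-opposite alt) (trans (cong neg x≡) (sym (z-opposite alt′)))
  alternating-unique {τ} {τ′} alt alt′ x≡ (vy i) =
    >-weakInduction (λ j → τ (vy j) ≡ τ′ (vy j))
      (trans (sym (top-equal alt)) (trans x≡ (top-equal alt′)))
      (λ j ih → trans (y-step alt j) (trans (cong neg ih) (sym (y-step alt′ j))))
      i

-- paritySpin n i = (-1)^(n - i)
paritySpin : (n : ℕ) → Fin (suc n) → Spin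
paritySpin zero    fzero    = plus
paritySpin (suc n) fzero    = neg (paritySpin n fzero)
paritySpin (suc n) (fsuc i) = paritySpin n i

paritySpin-top : (n : ℕ) → paritySpin n (fromℕ n) ≡ plus
paritySpin-top zero    = refl
paritySpin-top (suc n) = paritySpin-top n

paritySpin-step : (n : ℕ) (i : Fin n) →
  paritySpin n (inject₁ i) ≡ neg (paritySpin n (fsuc i))
paritySpin-step (suc n) fzero    = refl
paritySpin-step (suc n) (fsuc i) = paritySpin-step n i

canonical : (n : ℕ) → SpinAssignment n
canonical n vx     = plus
canonical n vz     = minus
canonical n (vy i) = paritySpin n i

canonical-alternating : (n : ℕ) → Alternating (canonical n)
canonical-alternating n = record
  { z-opposite = refl
  ; top-equal  = sym (paritySpin-top n)
  ; y-step     = paritySpin-step n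
  }

alternating-canonical-or-neg : {n : ℕ} {τ : SpinAssignment n} → Alternating τ →
  (∀ v → τ v ≡ canonical n v) ⊎ (∀ v → τ v ≡ neg (canonical n v))
alternating-canonical-or-neg {n} {τ} alt with τ vx in x≡
... | plus  = inj₁ (alternating-unique alt (canonical-alternating n) x≡)
... | minus = inj₂ (alternating-unique alt (alternating-neg (canonical-alternating n)) x≡)

mainTheorem3 : (n : ℕ) → 0 < n →
    Σ (SpinAssignment n) (λ σ →
    (τ : SpinAssignment n) →
    ((Satisfying τ × τ vx ≡ τ (yLast n))
    → ((∀ v → τ v ≡ σ v) ⊎ (∀ v → τ v ≡ neg (σ v))))
    × (((∀ v → τ v ≡ σ v) ⊎ (∀ v → τ v ≡ neg (σ v)))
    → (Satisfying τ × τ vx ≡ τ (yLast n))))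
mainTheorem3 n _ = canonical n , λ τ → forward τ , backward τ
  where
  fromAlternating : {τ : SpinAssignment n} → Alternating τ → Satisfying τ × τ vx ≡ τ (yLast n)
  fromAlternating alt = alternating⇒satisfying alt , top-equal alt

  forward : (τ : SpinAssignment n) → Satisfying τ × τ vx ≡ τ (yLast n) →
    (∀ v → τ v ≡ canonical n v) ⊎ (∀ v → τ v ≡ neg (canonical n v))
  forward τ (sat , x≡y) = alternating-canonical-or-neg (satisfying⇒alternating sat x≡y)

  backward : (τ : SpinAssignment n) →
    (∀ v → τ v ≡ canonical n v) ⊎ (∀ v → τ v ≡ neg (canonical n v)) →
    Satisfying τ × τ vx ≡ τ (yLast n)
  backward τ (inj₁ τ≗σ) =
    fromAlternating (alternating-resp (λ v → sym (τ≗σ v)) (canonical-alternating n))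
  backward τ (inj₂ τ≗-σ) =
    fromAlternating (alternating-resp (λ v → sym (τ≗-σ v)) (alternating-neg (canonical-alternating n)))
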